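{- Let $k$ be a positive integer and let $H$ be a graph whose chromatic number is $t+1 \geq 3$. Then there exists a constant $c$ such that $g(H,k) \leq t e^{ck/t}$.
   Context: A graph is $H$-free if it contains no (not necessarily induced) copy of $H$. A graph is $k$-choosable if it can be properly coloured from the lists for every assignment of lists of size $k$ to its vertices. $g(H,k)$ is the largest integer $g$ such that every $H$-free graph on at most $g$ vertices is $k$-choosable. -}

module Defs where

open import Data.Nat using (ℕ; _≤_)
open import Data.Fin using (Fin)
open import Data.Bool using (Bool; T)
open import Data.List using (List; length)
open import Data.List.Membership.Propositional using (_∈_)
open import Data.List.Relation.Unary.Unique.Propositional using (Unique)
open import Data.Product using (Σ; ∃; _×_)
open import Relation.Binary.PropositionalEquality using (_≡_; _≢_)
open import Relation.Nullary using (¬_)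
open import Function.Definitions using (Injective)

record Graph (n : ℕ) : Set where
  field
    adj   : Fin n → Fin n → Bool
    sym   : ∀ u v → adj u v ≡ adj v u
    irrefl : ∀ v → adj v v ≡ Data.Bool.false

open Graph public

Adj : ∀ {n} → Graph n → Fin n → Fin n → Set
Adj G u v = T (adj G u v)

Contains : ∀ {n h} → Graph n → Graph h → Set
Contains {n} {h} G H =
  Σ (Fin h → Fin n) λ φ →
    Injective _≡_ _≡_ φ × (∀ a b → Adj H a b → Adj G (φ a) (φ b))

_IsFree_ : ∀ {n h} → Graph n → Graph h → Set
G IsFree H = ¬ Contains G H

Colourable : ∀ {n} → Graph n → ℕ → Set
Colourable {n} G m =
  Σ (Fin n → Fin m) λ c → ∀ u v → Adj G u v → c u ≢ c v

ChromaticNumber : ∀ {n} → Graph n → ℕ → Set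
ChromaticNumber G m =
  Colourable G m × (∀ j → Colourable G j → m ≤ j)

ListAssignment : ℕ → ℕ → Set
ListAssignment n k =
  Σ (Fin n → List ℕ) λ L → ∀ v → Unique (L v) × length (L v) ≡ k

Choosable : ∀ {n} → Graph n → ℕ → Set
Choosable {n} G k =
  (LA : ListAssignment n k) →
  Σ (Fin n → ℕ) λ f →
    (∀ v → f v ∈ Data.Product.proj₁ LA v) × (∀ u v → Adj G u v → f u ≢ f v)

-- "every H-free graph on at most g vertices is k-choosable";
-- g(H,k) is the largest g with this property.
AllFreeChoosable : ∀ {h} → Graph h → ℕ → ℕ → Set
AllFreeChoosable H k g =
  ∀ n → n ≤ g → (G : Graph n) → G IsFree H → Choosable G k

{-# OPTIONS --safe #-}
module Submission where

-- Write k = r + s w with w ≈ t / 3 and r < w, and take the complete t-partite graph whose parts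
-- consist of one vertex for each type τ : Fin 2s → Fin 2.  A vertex of type τ gets the r common
-- colours and the colours (j , a), a < w, for s coordinates j, preferring those with τ j = 0.
-- The graph is t-colourable, hence H-free.  In a list colouring distinct parts use disjoint colours.
-- A part using no common colour uses more than s coordinates: otherwise the list of its vertex
-- whose type prefers exactly the unused coordinates contains no used coordinate.  So every part owns
-- s + 1 "tokens" (a common colour with an index, or a coordinate colour), and there are only
-- r (s + 1) + 2 s w < t (s + 1) of them.  Hence g(H,k) < t 4^s, and 4^(s t) ≤ 256^k as t ≤ 4 w.

open import Defs hiding (sym)

open import Data.Bool using (false)
open import Data.Empty using (⊥-elim)
open import Data.Fin
  using (Fin; zero; suc; _≟_; toℕ; inject≤; combine; quotient; remainder; finToFun; funToFin)
open import Data.Fin.Properties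
  using (toℕ-injective; inject≤-injective; remQuot-combine; finToFun-funToFin; +↔⊎; *↔×; any?; injective⇒≤)
open import Data.List
  using (List; []; _∷_; _++_; take; filter; length; lookup; map; cartesianProduct; allFin)
open import Data.List.Properties using (length-++; length-map; length-take; length-tabulate)
open import Data.List.Membership.Propositional using (_∈_)
open import Data.List.Membership.Propositional.Properties
  using (∈-filter⁻; ∈-lookup; ∈-map⁻; ∈-++⁻; ∈-cartesianProduct⁻)
open import Data.List.Relation.Unary.All as All using ()
open import Data.List.Relation.Unary.AllPairs using (_∷_)
open import Data.List.Relation.Unary.Any using (here; there)
open import Data.List.Relation.Unary.Unique.Propositional using (Unique)
import Data.List.Relation.Unary.Unique.Propositional.Properties as Unique
open import Data.Nat using (ℕ; zero; suc; _+_; _*_; _^_; _/_; _%_; _⊓_; _≤_; _<_; s≤s; z≤n; s≤s⁻¹)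
open import Data.Nat.DivMod using (m≡m%n+[m/n]*n; m%n<n; m/n*n≤m)
open import Data.Nat.Properties
  using ( +-suc; m≤m+n; m≤n+m; m<m+n; <⇒≤; ≰⇒>; <⇒≱; 1+n≰n; m≤n⇒m⊓n≡m
        ; +-monoˡ-≤; +-monoʳ-≤; +-monoˡ-<; +-cancelˡ-<; *-monoˡ-≤; *-monoʳ-≤; *-monoʳ-<
        ; ^-*-assoc; ^-monoˡ-≤; ^-monoʳ-≤; *-commutativeSemigroup; module ≤-Reasoning)
open import Data.Nat.Tactic.RingSolver using (solve; solve-∀)
open import Algebra.Properties.CommutativeSemigroup *-commutativeSemigroup
  using () renaming (interchange to *-interchange)
open import Data.Product using (Σ; ∃-syntax; _×_; _,_; proj₁; proj₂)
open import Data.Product.Properties using () renaming (≡-dec to ×-≡-dec)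
open import Data.Sum as Sum using (_⊎_; inj₁; inj₂)
open import Data.Sum.Function.Propositional using (_⊎-↔_)
open import Data.Sum.Properties using (≡-dec; inj₁-injective; inj₂-injective)
open import Function using (_∘_)
open import Function.Bundles using (_↔_; _↣_; Inverse; Injection; mk↣)
open import Function.Construct.Composition using (_↣-∘_; _↔-∘_)
open import Function.Construct.Identity using (↔-id)
open import Function.Construct.Symmetry using (↔-sym)
open import Function.Definitions using (Injective)
open import Function.Properties.Inverse using (↔⇒↣)
open import Level using (0ℓ)
open import Relation.Binary.Definitions using (DecidableEquality)
open import Relation.Binary.PropositionalEquality
  using (_≡_; _≢_; refl; sym; trans; cong; cong₂; subst; module ≡-Reasoning)
open import Relation.Nullary using (¬_; Dec; yes; no; isNo; _×-dec_)
open import Relation.Nullary.Decidable using (fromWitnessFalse; toWitnessFalse; decidable-stable)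
open import Relation.Unary using (Pred; Decidable)
open import Relation.Unary.Properties using (∁?)

completeMultipartite : ∀ {n t} → (Fin n → Fin t) → Graph n
completeMultipartite part = record
  { adj    = λ u v → isNo (part u ≟ part v)
  ; sym    = adj-sym
  ; irrefl = adj-irrefl
  }
  where
  adj-sym : ∀ u v → isNo (part u ≟ part v) ≡ isNo (part v ≟ part u)
  adj-sym u v with part u ≟ part v | part v ≟ part u
  ... | yes _  | yes _  = refl
  ... | no _   | no _   = refl
  ... | yes eq | no neq = ⊥-elim (neq (sym eq))
  ... | no neq | yes eq = ⊥-elim (neq (sym eq))

  adj-irrefl : ∀ v → isNo (part v ≟ part v) ≡ false
  adj-irrefl v with part v ≟ part v
  ... | yes _  = refl
  ... | no neq = ⊥-elim (neq refl)

module _ {n t} (part : Fin n → Fin t) where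

  Adj-completeMultipartite⁺ : ∀ {u v} → part u ≢ part v → Adj (completeMultipartite part) u v
  Adj-completeMultipartite⁺ = fromWitnessFalse

  Adj-completeMultipartite⁻ : ∀ {u v} → Adj (completeMultipartite part) u v → part u ≢ part v
  Adj-completeMultipartite⁻ = toWitnessFalse

  completeMultipartite-colourable : Colourable (completeMultipartite part) t
  completeMultipartite-colourable = part , λ u v → Adj-completeMultipartite⁻

colourable⇒free : ∀ {n h m} {G : Graph n} {H : Graph h} → Colourable G m → ¬ Colourable H m → G IsFree H
colourable⇒free (c , c-proper) ¬colourable (φ , _ , φ-adj) =
  ¬colourable (c ∘ φ , λ a b ab → c-proper (φ a) (φ b) (φ-adj a b ab))

chromaticNumber⇒¬colourable : ∀ {h m} (H : Graph h) → ChromaticNumber H (suc m) → ¬ Colourable H m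
chromaticNumber⇒¬colourable H (_ , minimal) colourable = 1+n≰n (minimal _ colourable)

length-allFin : ∀ m → length (allFin m) ≡ m
length-allFin m = length-tabulate (λ i → i)

module _ {A : Set} where

  ∈-take-++⁻ˡ : ∀ s {y} (xs ys : List A) → s ≤ length xs → y ∈ take s (xs ++ ys) → y ∈ xs
  ∈-take-++⁻ˡ (suc s) (x ∷ xs) ys _           (here y≡x)   = here y≡x
  ∈-take-++⁻ˡ (suc s) (x ∷ xs) ys (s≤s s≤∣xs∣) (there y∈ys) = there (∈-take-++⁻ˡ s xs ys s≤∣xs∣ y∈ys)

  lookup-injective : ∀ {xs : List A} → Unique xs → Injective _≡_ _≡_ (lookup xs)
  lookup-injective {x ∷ xs} (x∉xs ∷ _)   {zero}  {zero}  _  = refl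
  lookup-injective {x ∷ xs} (x∉xs ∷ _)   {zero}  {suc j} eq = ⊥-elim (All.lookup x∉xs (∈-lookup j) eq)
  lookup-injective {x ∷ xs} (x∉xs ∷ _)   {suc i} {zero}  eq = ⊥-elim (All.lookup x∉xs (∈-lookup i) (sym eq))
  lookup-injective {x ∷ xs} (_ ∷ xs!) {suc i} {suc j} eq = cong suc (lookup-injective xs! eq)

  Unique⇒injection : ∀ {m} {xs : List A} → Unique xs → m ≤ length xs →
                     Σ (Fin m → A) λ e → Injective _≡_ _≡_ e × (∀ i → e i ∈ xs)
  Unique⇒injection {xs = xs} xs! m≤∣xs∣ =
    (λ i → lookup xs (inject≤ i m≤∣xs∣)) ,
    (λ eq → inject≤-injective m≤∣xs∣ m≤∣xs∣ _ _ (lookup-injective xs! eq)) ,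
    (λ i → ∈-lookup (inject≤ i m≤∣xs∣))

  length-cartesianProduct : ∀ {B : Set} (xs : List A) (ys : List B) →
                            length (cartesianProduct xs ys) ≡ length xs * length ys
  length-cartesianProduct []       ys = refl
  length-cartesianProduct (x ∷ xs) ys = begin
    length (map (x ,_) ys ++ cartesianProduct xs ys)       ≡⟨ length-++ (map (x ,_) ys) ⟩
    length (map (x ,_) ys) + length (cartesianProduct xs ys) ≡⟨ cong₂ _+_ (length-map (x ,_) ys) (length-cartesianProduct xs ys) ⟩
    length ys + length xs * length ys                       ∎
    where open ≡-Reasoning

module _ {A : Set} {P : Pred A 0ℓ} (P? : Decidable P) where

  length-filter-∁ : ∀ xs → length (filter P? xs) + length (filter (∁? P?) xs) ≡ length xs
  length-filter-∁ []       = refl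
  length-filter-∁ (x ∷ xs) with P? x
  ... | yes _ = cong suc (length-filter-∁ xs)
  ... | no _  = trans (+-suc _ _) (cong suc (length-filter-∁ xs))

  takePreferring : ℕ → List A → List A
  takePreferring s xs = take s (filter P? xs ++ filter (∁? P?) xs)

  takePreferring-unique : ∀ s {xs} → Unique xs → Unique (takePreferring s xs)
  takePreferring-unique s {xs} xs! =
    Unique.take⁺ s (Unique.++⁺ (Unique.filter⁺ P? xs!) (Unique.filter⁺ (∁? P?) xs!) disjoint)
    where
    disjoint : ∀ {v} → ¬ (v ∈ filter P? xs × v ∈ filter (∁? P?) xs)
    disjoint (v∈P , v∈∁P) = proj₂ (∈-filter⁻ (∁? P?) {xs = xs} v∈∁P) (proj₂ (∈-filter⁻ P? {xs = xs} v∈P))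

  length-takePreferring : ∀ {s} xs → s ≤ length xs → length (takePreferring s xs) ≡ s
  length-takePreferring {s} xs s≤∣xs∣ = begin
    length (takePreferring s xs)                          ≡⟨ length-take s _ ⟩
    s ⊓ length (filter P? xs ++ filter (∁? P?) xs)        ≡⟨ cong (s ⊓_) (length-++ (filter P? xs)) ⟩
    s ⊓ (length (filter P? xs) + length (filter (∁? P?) xs)) ≡⟨ cong (s ⊓_) (length-filter-∁ xs) ⟩
    s ⊓ length xs                                         ≡⟨ m≤n⇒m⊓n≡m s≤∣xs∣ ⟩
    s                                                     ∎
    where open ≡-Reasoning

  takePreferring-∁ : ∀ s {y} xs → y ∈ takePreferring s xs → ¬ P y →
                     length xs < s + length (filter (∁? P?) xs)
  takePreferring-∁ s xs y∈ ¬Py =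
    subst (_< s + length (filter (∁? P?) xs)) (length-filter-∁ xs) (+-monoˡ-< _ fewPreferred)
    where
    fewPreferred : length (filter P? xs) < s
    fewPreferred = ≰⇒> λ s≤ → ¬Py (proj₂ (∈-filter⁻ P? {xs = xs} (∈-take-++⁻ˡ s _ (filter (∁? P?) xs) s≤ y∈)))

↣⇒≤ : ∀ {m n} {A B : Set} → Fin m ↔ A → Fin n ↔ B → A ↣ B → m ≤ n
↣⇒≤ Fin↔A Fin↔B A↣B =
  injective⇒≤ (Injection.injective (↔⇒↣ (↔-sym Fin↔B) ↣-∘ (A↣B ↣-∘ ↔⇒↣ Fin↔A)))

^-distribʳ-* : ∀ m n o → (m * n) ^ o ≡ m ^ o * n ^ o
^-distribʳ-* m n zero    = refl
^-distribʳ-* m n (suc o) = begin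
  m * n * (m * n) ^ o       ≡⟨ cong (m * n *_) (^-distribʳ-* m n o) ⟩
  m * n * (m ^ o * n ^ o)   ≡⟨ *-interchange m n (m ^ o) (n ^ o) ⟩
  m * m ^ o * (n * n ^ o)   ∎
  where open ≡-Reasoning

r*[1+s]+[s+s]*w<t*[1+s] : ∀ {r s w t} → 0 < w → r + 2 * w ≤ t → r * suc s + (s + s) * w < t * suc s
r*[1+s]+[s+s]*w<t*[1+s] {r} {s} {w} {t} 0<w r+2w≤t = begin-strict
  r * suc s + (s + s) * w          <⟨ m<m+n _ (*-monoʳ-< 2 0<w) ⟩
  r * suc s + (s + s) * w + 2 * w  ≡⟨ solve (r ∷ s ∷ w ∷ []) ⟩
  (r + 2 * w) * suc s              ≤⟨ *-monoˡ-≤ (suc s) r+2w≤t ⟩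
  t * suc s                        ∎
  where open ≤-Reasoning

module Construction (t s r w : ℕ) where

  M : ℕ
  M = s + s

  Colour : Set
  Colour = Fin r ⊎ (Fin M × Fin w)

  _≟ᶜ_ : DecidableEquality Colour
  _≟ᶜ_ = ≡-dec _≟_ (×-≡-dec _≟_ _≟_)

  Fin↔Colour : Fin (r + M * w) ↔ Colour
  Fin↔Colour = (↔-id (Fin r) ⊎-↔ *↔×) ↔-∘ +↔⊎

  code : Colour → ℕ
  code c = toℕ (Inverse.from Fin↔Colour c)

  code-injective : Injective _≡_ _≡_ code
  code-injective eq = Injection.injective (↔⇒↣ (↔-sym Fin↔Colour)) (toℕ-injective eq)

  n : ℕ
  n = t * 2 ^ M

  part : Fin n → Fin t
  part = quotient (2 ^ M)

  type : Fin n → Fin M → Fin 2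
  type v = finToFun (remainder {t} (2 ^ M) v)

  vertex : Fin t → (Fin M → Fin 2) → Fin n
  vertex i τ = combine i (funToFin τ)

  part-vertex : ∀ i τ → part (vertex i τ) ≡ i
  part-vertex i τ = cong proj₁ (remQuot-combine i (funToFin τ))

  type-vertex : ∀ i τ j → type (vertex i τ) j ≡ τ j
  type-vertex i τ j =
    trans (cong (λ x → finToFun (proj₂ x) j) (remQuot-combine i (funToFin τ))) (finToFun-funToFin τ j)

  preferred? : (τ : Fin M → Fin 2) → Decidable (λ j → τ j ≡ zero)
  preferred? τ j = τ j ≟ zero

  coordinates : (Fin M → Fin 2) → List (Fin M)
  coordinates τ = takePreferring (preferred? τ) s (allFin M)

  palette : (Fin M → Fin 2) → List Colour
  palette τ = map inj₁ (allFin r) ++ map inj₂ (cartesianProduct (coordinates τ) (allFin w))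

  palette-unique : ∀ τ → Unique (palette τ)
  palette-unique τ = Unique.++⁺
    (Unique.map⁺ inj₁-injective (Unique.allFin⁺ r))
    (Unique.map⁺ inj₂-injective (Unique.cartesianProduct⁺
      (takePreferring-unique (preferred? τ) s (Unique.allFin⁺ M)) (Unique.allFin⁺ w)))
    disjoint
    where
    disjoint : ∀ {c} → ¬ (c ∈ map inj₁ (allFin r) × c ∈ map inj₂ (cartesianProduct (coordinates τ) (allFin w)))
    disjoint (c∈₁ , c∈₂) with ∈-map⁻ inj₁ c∈₁ | ∈-map⁻ inj₂ c∈₂
    ... | _ , _ , refl | _ , _ , ()

  length-palette : ∀ τ → length (palette τ) ≡ r + s * w
  length-palette τ = begin
    length (palette τ)                                             ≡⟨ length-++ (map inj₁ (allFin r)) ⟩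
    length (map inj₁ (allFin r)) + length (map inj₂ coordinates×w) ≡⟨ cong₂ _+_ (length-map inj₁ (allFin r)) (length-map inj₂ coordinates×w) ⟩
    length (allFin r) + length coordinates×w                        ≡⟨ cong₂ _+_ (length-allFin r) (length-cartesianProduct (coordinates τ) (allFin w)) ⟩
    r + length (coordinates τ) * length (allFin w)                  ≡⟨ cong₂ (λ x y → r + x * y) ∣coordinates∣≡s (length-allFin w) ⟩
    r + s * w                                                       ∎
    where
    open ≡-Reasoning
    coordinates×w = cartesianProduct (coordinates τ) (allFin w)
    ∣coordinates∣≡s : length (coordinates τ) ≡ s
    ∣coordinates∣≡s = length-takePreferring (preferred? τ) (allFin M)
      (subst (s ≤_) (sym (length-allFin M)) (m≤m+n s s))

  G : Graph n
  G = completeMultipartite part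

  L : ListAssignment n (r + s * w)
  L = (λ v → map code (palette (type v))) ,
      (λ v → Unique.map⁺ code-injective (palette-unique (type v)) ,
             trans (length-map code (palette (type v))) (length-palette (type v)))

  module _ (f : Fin n → ℕ) (f∈L : ∀ v → f v ∈ proj₁ L v) (f-proper : ∀ u v → Adj G u v → f u ≢ f v) where

    colour : Fin n → Colour
    colour v = proj₁ (∈-map⁻ code (f∈L v))

    colour-∈ : ∀ v → colour v ∈ palette (type v)
    colour-∈ v = proj₁ (proj₂ (∈-map⁻ code (f∈L v)))

    f≡code∘colour : ∀ v → f v ≡ code (colour v)
    f≡code∘colour v = proj₂ (proj₂ (∈-map⁻ code (f∈L v)))

    UsedBy : Fin t → Colour → Set
    UsedBy i c = ∃[ v ] part v ≡ i × colour v ≡ c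

    usedBy? : ∀ i c → Dec (UsedBy i c)
    usedBy? i c = any? λ v → (part v ≟ i) ×-dec (colour v ≟ᶜ c)

    usedBy-vertex : ∀ i τ → UsedBy i (colour (vertex i τ))
    usedBy-vertex i τ = vertex i τ , part-vertex i τ , refl

    usedBy-unique : ∀ {i i′ c} → UsedBy i c → UsedBy i′ c → i ≡ i′
    usedBy-unique (u , refl , refl) (v , refl , cv≡cu) =
      decidable-stable (part u ≟ part v) λ parts≢ →
        f-proper u v (Adj-completeMultipartite⁺ part parts≢) (begin
          f u             ≡⟨ f≡code∘colour u ⟩
          code (colour u) ≡⟨ cong code (sym cv≡cu) ⟩
          code (colour v) ≡⟨ sym (f≡code∘colour v) ⟩
          f v             ∎)
      where open ≡-Reasoning

    CommonUsed : Fin t → Set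
    CommonUsed i = ∃[ c ] UsedBy i (inj₁ c)

    commonUsed? : ∀ i → Dec (CommonUsed i)
    commonUsed? i = any? λ c → usedBy? i (inj₁ c)

    CoordinateUsed : Fin t → Fin M → Set
    CoordinateUsed i j = ∃[ a ] UsedBy i (inj₂ (j , a))

    coordinateUsed? : ∀ i j → Dec (CoordinateUsed i j)
    coordinateUsed? i j = any? λ a → usedBy? i (inj₂ (j , a))

    module _ (i : Fin t) (¬common : ¬ CommonUsed i) where

      unused : Fin M → Fin 2
      unused j with coordinateUsed? i j
      ... | yes _ = suc zero
      ... | no _  = zero

      v* : Fin n
      v* = vertex i unused

      used⇒unpreferred : ∀ j → CoordinateUsed i j → type v* j ≢ zero
      used⇒unpreferred j used rewrite type-vertex i unused j with coordinateUsed? i j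
      ... | yes _     = λ ()
      ... | no ¬used  = ⊥-elim (¬used used)

      unpreferred⇒used : ∀ j → type v* j ≢ zero → CoordinateUsed i j
      unpreferred⇒used j unpreferred rewrite type-vertex i unused j with coordinateUsed? i j
      ... | yes used = used
      ... | no _     = ⊥-elim (unpreferred refl)

      colour-v*≡coordinate : ∃[ j ] ∃[ a ] j ∈ coordinates (type v*) × colour v* ≡ inj₂ (j , a)
      colour-v*≡coordinate with ∈-++⁻ (map inj₁ (allFin r)) (colour-∈ v*)
      ... | inj₁ c∈ with c , _ , eq ← ∈-map⁻ inj₁ c∈ =
        ⊥-elim (¬common (c , subst (UsedBy i) eq (usedBy-vertex i unused)))
      ... | inj₂ c∈ with (j , a) , ja∈ , eq ← ∈-map⁻ inj₂ c∈ =
        j , a , proj₁ (∈-cartesianProduct⁻ (coordinates (type v*)) (allFin w) ja∈) , eq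

      many-unpreferred : suc s ≤ length (filter (∁? (preferred? (type v*))) (allFin M))
      many-unpreferred with j , a , j∈ , eq ← colour-v*≡coordinate =
        +-cancelˡ-< s s _ (subst (_< s + length unpreferred) (length-allFin M)
          (takePreferring-∁ (preferred? (type v*)) s (allFin M) j∈
            (used⇒unpreferred j (a , subst (UsedBy i) eq (usedBy-vertex i unused)))))
        where unpreferred = filter (∁? (preferred? (type v*))) (allFin M)

      usedCoordinateColours : Σ (Fin (suc s) → Fin M × Fin w) λ e →
                              Injective _≡_ _≡_ e × ∀ m → UsedBy i (inj₂ (e m))
      usedCoordinateColours =
        let e , e-injective , e∈unpreferred = Unique⇒injection unpreferred! many-unpreferred
            used : ∀ m → CoordinateUsed i (e m)
            used m = unpreferred⇒used (e m) (proj₂ (∈-filter⁻ (∁? (preferred? (type v*))) {xs = allFin M} (e∈unpreferred m)))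
        in (λ m → e m , proj₁ (used m)) , (λ eq → e-injective (cong proj₁ eq)) , (λ m → proj₂ (used m))
        where unpreferred! = Unique.filter⁺ (∁? (preferred? (type v*))) (Unique.allFin⁺ M)

    Token : Set
    Token = (Fin r × Fin (suc s)) ⊎ (Fin M × Fin w)

    Fin↔Token : Fin (r * suc s + M * w) ↔ Token
    Fin↔Token = (*↔× ⊎-↔ *↔×) ↔-∘ +↔⊎

    tokenColour : Token → Colour
    tokenColour = Sum.map₁ proj₁

    tokensOf : ∀ i → Dec (CommonUsed i) → Fin (suc s) → Token
    tokensOf i (yes (c , _))  m = inj₁ (c , m)
    tokensOf i (no ¬common)   m = inj₂ (proj₁ (usedCoordinateColours i ¬common) m)

    tokensOf-usedBy : ∀ i d m → UsedBy i (tokenColour (tokensOf i d m))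
    tokensOf-usedBy i (yes (c , used)) m = used
    tokensOf-usedBy i (no ¬common)     m = proj₂ (proj₂ (usedCoordinateColours i ¬common)) m

    tokensOf-injective : ∀ i d → Injective _≡_ _≡_ (tokensOf i d)
    tokensOf-injective i (yes _)      refl = refl
    tokensOf-injective i (no ¬common) eq   = proj₁ (proj₂ (usedCoordinateColours i ¬common)) (inj₂-injective eq)

    token : Fin t × Fin (suc s) → Token
    token (i , m) = tokensOf i (commonUsed? i) m

    token-injective : Injective _≡_ _≡_ token
    token-injective {i , m} {i′ , m′} eq
      with refl ← usedBy-unique (tokensOf-usedBy i (commonUsed? i) m)
                    (subst (UsedBy i′ ∘ tokenColour) (sym eq) (tokensOf-usedBy i′ (commonUsed? i′) m′)) =
      cong (i ,_) (tokensOf-injective i (commonUsed? i) eq)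

    t*[1+s]≤r*[1+s]+M*w : t * suc s ≤ r * suc s + M * w
    t*[1+s]≤r*[1+s]+M*w = ↣⇒≤ *↔× Fin↔Token (mk↣ token-injective)

  ¬choosable : 0 < w → r + 2 * w ≤ t → ¬ Choosable G (r + s * w)
  ¬choosable 0<w r+2w≤t choosable =
    let f , f∈L , f-proper = choosable L
    in <⇒≱ (r*[1+s]+[s+s]*w<t*[1+s] {r} {s} 0<w r+2w≤t) (t*[1+s]≤r*[1+s]+M*w f f∈L f-proper)

module Parameters (t′ k : ℕ) where

  q t w s r : ℕ
  q = t′ / 3
  t = 2 + t′
  w = suc q
  s = k / w
  r = k % w

  k≡r+s*w : k ≡ r + s * w
  k≡r+s*w = m≡m%n+[m/n]*n k w

  r+2w≤t : r + 2 * w ≤ t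
  r+2w≤t = begin
    r + 2 * w   ≤⟨ +-monoˡ-≤ (2 * w) (s≤s⁻¹ (m%n<n k w)) ⟩
    q + 2 * w   ≡⟨ q+2*[1+q]≡2+q*3 q ⟩
    2 + q * 3   ≤⟨ +-monoʳ-≤ 2 (m/n*n≤m t′ 3) ⟩
    t           ∎
    where
    open ≤-Reasoning
    q+2*[1+q]≡2+q*3 : ∀ q → q + 2 * suc q ≡ 2 + q * 3
    q+2*[1+q]≡2+q*3 = solve-∀

  t≤4w : t ≤ 4 * w
  t≤4w = begin
    2 + t′                  ≡⟨ cong (2 +_) (m≡m%n+[m/n]*n t′ 3) ⟩
    2 + (t′ % 3 + q * 3)    ≤⟨ +-monoʳ-≤ 2 (+-monoˡ-≤ (q * 3) (s≤s⁻¹ (m%n<n t′ 3))) ⟩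
    2 + (2 + q * 3)         ≤⟨ m≤m+n _ q ⟩
    2 + (2 + q * 3) + q     ≡⟨ [2+[2+q*3]]+q≡4*[1+q] q ⟩
    4 * w                   ∎
    where
    open ≤-Reasoning
    [2+[2+q*3]]+q≡4*[1+q] : ∀ q → 2 + (2 + q * 3) + q ≡ 4 * suc q
    [2+[2+q*3]]+q≡4*[1+q] = solve-∀

  vertexCount-bound : (t * 2 ^ (s + s)) ^ t ≤ t ^ t * 256 ^ k
  vertexCount-bound = begin
    (t * 2 ^ (s + s)) ^ t         ≡⟨ ^-distribʳ-* t (2 ^ (s + s)) t ⟩
    t ^ t * (2 ^ (s + s)) ^ t     ≡⟨ cong (t ^ t *_) (^-*-assoc 2 (s + s) t) ⟩
    t ^ t * 2 ^ ((s + s) * t)     ≤⟨ *-monoʳ-≤ (t ^ t) (^-monoʳ-≤ 2 exponent-bound) ⟩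
    t ^ t * 2 ^ (8 * k)           ≡⟨ cong (t ^ t *_) (sym (^-*-assoc 2 8 k)) ⟩
    t ^ t * 256 ^ k               ∎
    where
    open ≤-Reasoning
    [s+s]*[4*w]≡8*[s*w] : ∀ s w → (s + s) * (4 * w) ≡ 8 * (s * w)
    [s+s]*[4*w]≡8*[s*w] = solve-∀
    exponent-bound : (s + s) * t ≤ 8 * k
    exponent-bound = begin
      (s + s) * t        ≤⟨ *-monoʳ-≤ (s + s) t≤4w ⟩
      (s + s) * (4 * w)  ≡⟨ [s+s]*[4*w]≡8*[s*w] s w ⟩
      8 * (s * w)        ≤⟨ *-monoʳ-≤ 8 (subst (s * w ≤_) (sym k≡r+s*w) (m≤n+m (s * w) r)) ⟩
      8 * k              ∎

proposition3p1 : Σ ℕ λ C →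
    ∀ (k t h : ℕ) (H : Graph h) → 1 ≤ k → 2 ≤ t → ChromaticNumber H (suc t) →
      ∀ g → AllFreeChoosable H k g → g ^ t ≤ (t ^ t) * (C ^ k)
proposition3p1 = 256 , bound
  where
  bound : ∀ (k t h : ℕ) (H : Graph h) → 1 ≤ k → 2 ≤ t → ChromaticNumber H (suc t) →
          ∀ g → AllFreeChoosable H k g → g ^ t ≤ (t ^ t) * (256 ^ k)
  bound k (suc (suc t′)) h H _ _ χ g g-choosable = begin
    g ^ t             ≤⟨ ^-monoˡ-≤ t (<⇒≤ g<n) ⟩
    n ^ t             ≤⟨ vertexCount-bound ⟩
    t ^ t * 256 ^ k   ∎
    where
    open ≤-Reasoning
    open Parameters t′ k
    open Construction t s r w
    G-free : G IsFree H
    G-free = colourable⇒free {G = G} {H = H} (completeMultipartite-colourable part) (chromaticNumber⇒¬colourable H χ)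
    g<n : g < n
    g<n = ≰⇒> λ n≤g → ¬choosable (s≤s z≤n) r+2w≤t
      (subst (Choosable G) k≡r+s*w (g-choosable n n≤g G G-free))
  bound k 1 h H _ (s≤s ()) χ g g-choosable
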